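{- Let $q=2$. Under $G_2$ there are exactly $6$ line orbits, each a union of $G_2^*$-orbits (where each set of lines of a single type listed below is one $G_2^*$-orbit): (1) the RC-lines; (2) the IA-lines; (3) the $\mathrm U\Gamma_2$-lines; (4) the RA-lines together with the IC-lines; (5) the T-lines together with the $\mathrm U\Gamma_1$-lines and the $\mathrm{Un}\Gamma$-lines; (6) the $\mathrm E\Gamma$-lines together with the $\mathrm{En}\Gamma$-lines.
   Context: Points of $\mathrm{PG}(3,q)$ are written $\mathbf{P}(x_0,x_1,x_2,x_3)$. For $t\in\mathbb{F}_q$ (or $t\in\mathbb F_{q^2}$, giving points of $\mathrm{PG}(3,q^2)$) put $P(t)=\mathbf{P}(t^3,t^2,t,1)$, and $P(\infty)=\mathbf{P}(1,0,0,0)$. For $q=2$ the twisted cubic is $\mathcal{C}=\{P(0),P(1),P(\infty)\}$. $G_2$ is the group of all projectivities of $\mathrm{PG}(3,2)$ mapping $\mathcal C$ to itself. $G_2^*$ is the subgroup of $G_2$ of projectivities given by matrices $$M(a,b,c,d)=\begin{pmatrix} a^3&a^2c&ac^2&c^3\\ 3a^2b&a^2d+2abc&bc^2+2acd&3c^2d\\ 3ab^2&b^2c+2abd&ad^2+2bcd&3cd^2\\ b^3&b^2d&bd^2&d^3\end{pmatrix},\quad a,b,c,d\in\mathbb F_2,\ ad-bc\ne0,$$ with coefficients read in $\mathbb F_2$. The osculating plane at $P(t)$ is $x_0-3tx_1+3t^2x_2-t^3x_3=0$ and at $P(\infty)$ it is $x_3=0$; the ones with $t\in\mathbb F_2\cup\{\infty\}$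 are the $\Gamma$-planes. The tangent at $P(t)$, $t\in\mathbb F_2$, is the line through $P(t)$ and $\mathbf P(3t^2,2t,1,0)$; at $P(\infty)$ it is the line through $\mathbf P(1,0,0,0)$ and $\mathbf P(0,1,0,0)$. A unisecant is a line meeting $\mathcal C$ in exactly one point; an external line is a line containing no point of $\mathcal C$. Line types: RC-line: a line through two distinct points of $\mathcal C$; RA-line: the intersection of two distinct $\Gamma$-planes; T-line: a tangent; IC-line: a line of $\mathrm{PG}(3,2)$ joining $P(t)$ and $P(t^2)$ for some $t\in\mathbb F_{4}\setminus\mathbb F_2$; IA-line: a line of $\mathrm{PG}(3,2)$ that is the intersection of the osculating planes at $P(t)$ and $P(t^2)$ for some $t\in\mathbb F_{4}\setminus\mathbb F_2$; $\mathrm{U}\Gamma$-line: a unisecant contained in a $\Gamma$-plane which is not a tangent; $\mathrm U\Gamma_2$-line: a $\mathrm U\Gamma$-line contained in the plane $x_1=x_2$; $\mathrm U\Gamma_1$-line: a $\mathrm U\Gamma$-line not contained in the plane $x_1=x_2$; $\mathrm{Un}\Gamma$-line: a unisecant not contained in any $\Gamma$-plane; $\mathrm{E}\Gamma$-line: an external line contained in a $\Gamma$-plane which is not an RA-line; $\mathrm{En}\Gamma$-line: an external line contained in no $\Gamma$-plane that is neither an IC-line nor an IA-line. -}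

module Defs where

open import Data.Bool using (Bool; true; false; _∧_; _xor_)
open import Data.Maybe using (Maybe; just; nothing)
open import Data.Vec using (Vec; []; _∷_; zipWith; replicate; foldr; map; lookup; tabulate)
open import Data.Fin using (Fin)
open import Data.Product using (Σ; ∃; _×_; _,_)
open import Data.Sum using (_⊎_)
open import Relation.Binary.PropositionalEquality using (_≡_; _≢_)
open import Relation.Nullary using (¬_)
open import Function.Bundles using (_⇔_)

F2 : Set
F2 = Bool

0₂ 1₂ : F2
0₂ = false
1₂ = true

infixl 6 _+₂_ _-₂_
infixl 7 _*₂_
_+₂_ _-₂_ _*₂_ : F2 → F2 → F2
a +₂ b = a xor b
a -₂ b = a xor b          -- characteristic 2
a *₂ b = a ∧ b

-- integer constants read in F₂
three₂ two₂ : F2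
three₂ = 1₂
two₂   = 0₂

_³₂ _²₂ : F2 → F2
a ²₂ = a *₂ a
a ³₂ = a *₂ (a *₂ a)

-- F₄ = {0, 1, ω, ω²} with ω² = ω + 1
data F4 : Set where
  𝟎 𝟏 ω ω² : F4

infixl 6 _+₄_
infixl 7 _*₄_
_+₄_ : F4 → F4 → F4
𝟎  +₄ y  = y
x  +₄ 𝟎  = x
𝟏  +₄ 𝟏  = 𝟎
𝟏  +₄ ω  = ω²
𝟏  +₄ ω² = ω
ω  +₄ 𝟏  = ω²
ω  +₄ ω  = 𝟎
ω  +₄ ω² = 𝟏
ω² +₄ 𝟏  = ω
ω² +₄ ω  = 𝟏
ω² +₄ ω² = 𝟎

_*₄_ : F4 → F4 → F4
𝟎  *₄ y  = 𝟎
𝟏  *₄ y  = y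
ω  *₄ 𝟎  = 𝟎
ω  *₄ 𝟏  = ω
ω  *₄ ω  = ω²
ω  *₄ ω² = 𝟏
ω² *₄ 𝟎  = 𝟎
ω² *₄ 𝟏  = ω²
ω² *₄ ω  = 𝟏
ω² *₄ ω² = ω

-- additive inverse (characteristic 2)
-₄_ : F4 → F4
-₄ x = x

three₄ : F4
three₄ = 𝟏   -- 3 = 1 in characteristic 2

ι : F2 → F4
ι false = 𝟎
ι true  = 𝟏

NotInF2 : F4 → Set
NotInF2 t = (t ≢ 𝟎) × (t ≢ 𝟏)

V2 : Set
V2 = Vec F2 4

V4 : Set
V4 = Vec F4 4

0v₂ : V2
0v₂ = replicate 4 0₂

0v₄ : V4
0v₄ = replicate 4 𝟎

_⊕_ : V2 → V2 → V2
_⊕_ = zipWith _+₂_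

ιv : V2 → V4
ιv = map ι

-- Points of PG(3,2) are the nonzero vectors of F₂⁴ (the only nonzero
-- scalar is 1, so distinct nonzero vectors are distinct points).

-- The twisted cubic C (q = 2), parametrised by F₂ ∪ {∞} = Maybe F2

P2 : Maybe F2 → V2
P2 (just t) = (t ³₂) ∷ (t ²₂) ∷ t ∷ 1₂ ∷ []
P2 nothing  = 1₂ ∷ 0₂ ∷ 0₂ ∷ 0₂ ∷ []

InC : V2 → Set
InC X = ∃ λ t → X ≡ P2 t

P4 : F4 → V4
P4 t = (t *₄ (t *₄ t)) ∷ (t *₄ t) ∷ t ∷ 𝟏 ∷ []

osc4 : F4 → V4 → F4
osc4 t (x0 ∷ x1 ∷ x2 ∷ x3 ∷ []) =
  x0 +₄ ((-₄ (three₄ *₄ t)) *₄ x1) +₄ ((three₄ *₄ (t *₄ t)) *₄ x2)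
     +₄ ((-₄ (t *₄ (t *₄ t))) *₄ x3)

-- Γ-planes: osculating planes at P(t), t ∈ F₂ ∪ {∞} (at ∞: x₃ = 0).
InΓPlane : Maybe F2 → V2 → Set
InΓPlane (just t) X = osc4 (ι t) (ιv X) ≡ 𝟎
InΓPlane nothing (x0 ∷ x1 ∷ x2 ∷ x3 ∷ []) = x3 ≡ 0₂

-- Lines of PG(3,2): given by two distinct points p, q; the line is the
-- point set {p, q, p+q}.

record Line : Set where
  constructor mkLine
  field
    p q  : V2
    p≢0  : p ≢ 0v₂
    q≢0  : q ≢ 0v₂
    p≢q  : p ≢ q
open Line public

OnSpan : V2 → V2 → V2 → Set
OnSpan A B X = (X ≡ A) ⊎ (X ≡ B) ⊎ (X ≡ A ⊕ B)

OnLine : Line → V2 → Set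
OnLine L = OnSpan (p L) (q L)

IsLineThrough : Line → V2 → V2 → Set
IsLineThrough L A B = ∀ X → OnLine L X ⇔ OnSpan A B X

OnExt : Line → V4 → Set
OnExt L Y = (Y ≢ 0v₄) ×
  (∃ λ λ₁ → ∃ λ μ →
     Y ≡ zipWith _+₄_ (map (λ₁ *₄_) (ιv (p L))) (map (μ *₄_) (ιv (q L))))

ContainedIn : Line → (V2 → Set) → Set
ContainedIn L S = ∀ X → OnLine L X → S X

InSomeΓPlane : Line → Set
InSomeΓPlane L = ∃ λ t → ContainedIn L (InΓPlane t)

RC : Line → Set
RC L = ∃ λ P → ∃ λ Q → InC P × InC Q × P ≢ Q × OnLine L P × OnLine L Q

RA : Line → Set
RA L = ∃ λ s → ∃ λ t → s ≢ t ×
  (∀ X → OnLine L X ⇔ ((X ≢ 0v₂) × InΓPlane s X × InΓPlane t X))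

tangentDir : Maybe F2 → V2
tangentDir (just t) = (three₂ *₂ (t ²₂)) ∷ (two₂ *₂ t) ∷ 1₂ ∷ 0₂ ∷ []
tangentDir nothing  = 0₂ ∷ 1₂ ∷ 0₂ ∷ 0₂ ∷ []

IsTangent : Line → Set
IsTangent L = ∃ λ t → IsLineThrough L (P2 t) (tangentDir t)

TL : Line → Set
TL = IsTangent

IC : Line → Set
IC L = ∃ λ t → NotInF2 t × OnExt L (P4 t) × OnExt L (P4 (t *₄ t))

IA : Line → Set
IA L = ∃ λ t → NotInF2 t ×
  (∀ Y → OnExt L Y ⇔ ((Y ≢ 0v₄) × osc4 t Y ≡ 𝟎 × osc4 (t *₄ t) Y ≡ 𝟎))

Unisecant : Line → Set
Unisecant L = ∃ λ P → InC P × OnLine L P × (∀ Q → InC Q → OnLine L Q → Q ≡ P)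

External : Line → Set
External L = ∀ P → InC P → ¬ OnLine L P

InPlaneX1=X2 : V2 → Set
InPlaneX1=X2 (x0 ∷ x1 ∷ x2 ∷ x3 ∷ []) = x1 ≡ x2

UΓ : Line → Set
UΓ L = Unisecant L × InSomeΓPlane L × ¬ IsTangent L

UΓ₂ : Line → Set
UΓ₂ L = UΓ L × ContainedIn L InPlaneX1=X2

UΓ₁ : Line → Set
UΓ₁ L = UΓ L × ¬ ContainedIn L InPlaneX1=X2

UnΓ : Line → Set
UnΓ L = Unisecant L × ¬ InSomeΓPlane L

EΓ : Line → Set
EΓ L = External L × InSomeΓPlane L × ¬ RA L

EnΓ : Line → Set
EnΓ L = External L × ¬ InSomeΓPlane L × ¬ IC L × ¬ IA L

-- Matrices and projectivities (acting on row vectors: X ↦ X·M)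

Mat : Set
Mat = Vec (Vec F2 4) 4

sum₂ : ∀ {n} → Vec F2 n → F2
sum₂ = foldr _ _+₂_ 0₂

_·_ : V2 → Mat → V2
X · M = tabulate λ j → sum₂ (zipWith _*₂_ X (map (λ row → lookup row j) M))

_⊗_ : Mat → Mat → Mat
A ⊗ B = map (_· B) A

Id : Mat
Id = (1₂ ∷ 0₂ ∷ 0₂ ∷ 0₂ ∷ []) ∷ (0₂ ∷ 1₂ ∷ 0₂ ∷ 0₂ ∷ []) ∷
     (0₂ ∷ 0₂ ∷ 1₂ ∷ 0₂ ∷ []) ∷ (0₂ ∷ 0₂ ∷ 0₂ ∷ 1₂ ∷ []) ∷ []

-- projectivities of PG(3,2) = invertible 4×4 matrices over F₂
Invertible : Mat → Set
Invertible g = ∃ λ h → (g ⊗ h ≡ Id) × (h ⊗ g ≡ Id)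

G2 : Mat → Set
G2 g = Invertible g ×
  (∀ t → ∃ λ s → P2 t · g ≡ P2 s) × (∀ s → ∃ λ t → P2 t · g ≡ P2 s)

M : F2 → F2 → F2 → F2 → Mat
M a b c d =
  (a ³₂ ∷ (a ²₂) *₂ c ∷ a *₂ (c ²₂) ∷ c ³₂ ∷ []) ∷
  (three₂ *₂ ((a ²₂) *₂ b) ∷ ((a ²₂) *₂ d) +₂ (two₂ *₂ (a *₂ (b *₂ c))) ∷
     (b *₂ (c ²₂)) +₂ (two₂ *₂ (a *₂ (c *₂ d))) ∷ three₂ *₂ ((c ²₂) *₂ d) ∷ []) ∷
  (three₂ *₂ (a *₂ (b ²₂)) ∷ ((b ²₂) *₂ c) +₂ (two₂ *₂ (a *₂ (b *₂ d))) ∷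
     (a *₂ (d ²₂)) +₂ (two₂ *₂ (b *₂ (c *₂ d))) ∷ three₂ *₂ (c *₂ (d ²₂)) ∷ []) ∷
  (b ³₂ ∷ (b ²₂) *₂ d ∷ b *₂ (d ²₂) ∷ d ³₂ ∷ []) ∷ []

G2* : Mat → Set
G2* g = ∃ λ a → ∃ λ b → ∃ λ c → ∃ λ d →
  ((a *₂ d) -₂ (b *₂ c) ≢ 0₂) × (g ≡ M a b c d)

SameOrbit : (Mat → Set) → Line → Line → Set
SameOrbit G L L' = ∃ λ g → G g ×
  (∀ X → OnLine L' X ⇔ (∃ λ Y → OnLine L Y × X ≡ Y · g))

OrbitPartition : (Mat → Set) → (I : Set) → (I → Line → Set) → Set
OrbitPartition G I S =
  (∀ i → ∃ λ L → S i L) ×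
  (∀ L → ∃ λ i → S i L) ×
  (∀ i j L → S i L → S j L → i ≡ j) ×
  (∀ i L L' → S i L → (S i L' ⇔ SameOrbit G L L'))

data LineType : Set where
  rc ia uγ₂ ra ic tl uγ₁ unγ eγ enγ : LineType

HasType : LineType → Line → Set
HasType rc  = RC
HasType ia  = IA
HasType uγ₂ = UΓ₂
HasType ra  = RA
HasType ic  = IC
HasType tl  = TL
HasType uγ₁ = UΓ₁
HasType unγ = UnΓ
HasType eγ  = EΓ
HasType enγ = EnΓ

InClass : Fin 6 → Line → Set
InClass Fin.zero L = RC L
InClass (Fin.suc Fin.zero) L = IA L
InClass (Fin.suc (Fin.suc Fin.zero)) L = UΓ₂ L
InClass (Fin.suc (Fin.suc (Fin.suc Fin.zero))) L = RA L ⊎ IC L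
InClass (Fin.suc (Fin.suc (Fin.suc (Fin.suc Fin.zero)))) L =
  TL L ⊎ UΓ₁ L ⊎ UnΓ L
InClass (Fin.suc (Fin.suc (Fin.suc (Fin.suc (Fin.suc Fin.zero))))) L =
  EΓ L ⊎ EnΓ L

{-# OPTIONS --safe #-}
module Submission where

-- PG(3,2) has only finitely many lines, so the ten G₂*-types are separated by deciding
-- them exhaustively: a cheap classifier is checked against their definitions, each of the
-- six matrices M(a,b,c,d) is checked to preserve it, and some M(a,b,c,d) carries a fixed
-- representative of each type onto every line of that type.
--
-- The coarser G₂-classes are invariant for a structural reason. Every g ∈ G₂ permutes the
-- three points of C, so it fixes their sum, the centre Z = (0,1,1,0); hence it preserves
-- the kind of a point: on C, equal to Z, on a chord of C (a point of Z + C), or off the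
-- plane x₁ = x₂ spanned by C. The G₂-class of a line is a function of the kinds of its
-- three points. Each G₂-class is a single orbit because involutions of G₂ outside G₂*
-- fuse the G₂*-orbits it contains.

open import Defs
open import Data.Fin using (Fin; #_; zero; suc)

open import Algebra.Bundles using (CommutativeRing)
import Algebra.Properties.CommutativeSemigroup as CommutativeSemigroupProperties
open import Data.Bool using (Bool; true; false; _∧_; _∨_)
open import Data.Bool.Properties using (∧-comm; ∧-distribʳ-xor; xor-∧-commutativeRing) renaming (_≟_ to _≟ᵇ_)
open import Data.Empty using (⊥-elim)
open import Data.Fin.Properties using (all?; any?) renaming (_≟_ to _≟ᶠ_)
open import Data.Maybe using (Maybe; just; nothing)
import Data.Maybe.Properties as Maybe
open import Data.Nat using (ℕ; _+_)
import Data.Nat as ℕ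
open import Data.Product using (∃; _×_; _,_; proj₁)
open import Data.Sum using (_⊎_; inj₁; inj₂)
open import Data.Vec using (Vec; []; _∷_; lookup; zipWith; map; count)
import Data.Vec.Properties as Vec
open import Function using (_$_)
open import Function.Bundles using (_⇔_; mk⇔; Equivalence)
open import Relation.Binary.Definitions using (DecidableEquality)
open import Relation.Binary.PropositionalEquality using (_≡_; _≢_; refl; sym; trans; cong; cong₂; subst; module ≡-Reasoning)
open import Relation.Nullary using (Dec; yes; no; does)
open import Relation.Nullary.Decidable using (map′; _×-dec_; _⊎-dec_; _→-dec_; ¬?; from-yes; does-⇔)
open import Relation.Unary using (Decidable)

open Equivalence

record Exhaustible (A : Set) : Set₁ where
  field
    ∀? : {P : A → Set} → Decidable P → Dec (∀ a → P a)
    ∃? : {P : A → Set} → Decidable P → Dec (∃ P)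

open Exhaustible {{...}}

record Enumeration (A : Set) : Set where
  field
    size       : ℕ
    enum       : Fin size → A
    index      : A → Fin size
    enum-index : ∀ a → enum (index a) ≡ a

  exhaustible : Exhaustible A
  exhaustible = record
    { ∀? = λ {P} P? → map′ (λ h a → subst P (enum-index a) (h (index a))) (λ h i → h (enum i))
                           (all? λ i → P? (enum i))
    ; ∃? = λ {P} P? → map′ (λ (i , h) → enum i , h) (λ (a , h) → index a , subst P (sym (enum-index a)) h)
                           (any? λ i → P? (enum i))
    }

  decEq : DecidableEquality A
  decEq a b = map′ (λ e → trans (sym (enum-index a)) (trans (cong enum e) (enum-index b))) (cong index)
                   (index a ≟ᶠ index b)

bool-enumeration : Enumeration Bool
bool-enumeration = record
  { size = 2 ; enum = lookup (false ∷ true ∷ []) ; index = λ { false → # 0 ; true → # 1 }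
  ; enum-index = λ { false → refl ; true → refl } }

f4-enumeration : Enumeration F4
f4-enumeration = record
  { size = 4 ; enum = lookup (𝟎 ∷ 𝟏 ∷ ω ∷ ω² ∷ [])
  ; index = λ { 𝟎 → # 0 ; 𝟏 → # 1 ; ω → # 2 ; ω² → # 3 }
  ; enum-index = λ { 𝟎 → refl ; 𝟏 → refl ; ω → refl ; ω² → refl } }

lineType-enumeration : Enumeration LineType
lineType-enumeration = record
  { size = 10
  ; enum = lookup (rc ∷ ia ∷ uγ₂ ∷ ra ∷ ic ∷ tl ∷ uγ₁ ∷ unγ ∷ eγ ∷ enγ ∷ [])
  ; index = λ { rc → # 0 ; ia → # 1 ; uγ₂ → # 2 ; ra → # 3 ; ic → # 4
              ; tl → # 5 ; uγ₁ → # 6 ; unγ → # 7 ; eγ → # 8 ; enγ → # 9 }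
  ; enum-index = λ { rc → refl ; ia → refl ; uγ₂ → refl ; ra → refl ; ic → refl
                   ; tl → refl ; uγ₁ → refl ; unγ → refl ; eγ → refl ; enγ → refl }
  }

instance
  fin-exhaustible : {n : ℕ} → Exhaustible (Fin n)
  fin-exhaustible = record { ∀? = all? ; ∃? = any? }

  bool-exhaustible : Exhaustible Bool
  bool-exhaustible = Enumeration.exhaustible bool-enumeration

  f4-exhaustible : Exhaustible F4
  f4-exhaustible = Enumeration.exhaustible f4-enumeration

  lineType-exhaustible : Exhaustible LineType
  lineType-exhaustible = Enumeration.exhaustible lineType-enumeration

  maybe-exhaustible : {A : Set} → {{Exhaustible A}} → Exhaustible (Maybe A)
  maybe-exhaustible = record
    { ∀? = λ {P} P? → map′ (λ (n , j) → λ { nothing → n ; (just a) → j a }) (λ h → h nothing , λ a → h (just a))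
                           (P? nothing ×-dec ∀? λ a → P? (just a))
    ; ∃? = λ {P} P? → map′ (λ { (inj₁ n) → nothing , n ; (inj₂ (a , j)) → just a , j })
                           (λ { (nothing , n) → inj₁ n ; (just a , j) → inj₂ (a , j) })
                           (P? nothing ⊎-dec ∃? λ a → P? (just a))
    }

  vec-exhaustible : {A : Set} {n : ℕ} → {{Exhaustible A}} → Exhaustible (Vec A n)
  vec-exhaustible {n = ℕ.zero} = record
    { ∀? = λ P? → map′ (λ { h [] → h }) (λ h → h []) (P? [])
    ; ∃? = λ P? → map′ ([] ,_) (λ { ([] , h) → h }) (P? [])
    }
  vec-exhaustible {A} {ℕ.suc n} = record
    { ∀? = λ P? → map′ (λ { h (a ∷ as) → h a as }) (λ h a as → h (a ∷ as))
                       (∀? λ a → ∀? {{vec-exhaustible {A} {n}}} λ as → P? (a ∷ as))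
    ; ∃? = λ P? → map′ (λ { (a , as , h) → a ∷ as , h }) (λ { (a ∷ as , h) → a , as , h })
                       (∃? λ a → ∃? {{vec-exhaustible {A} {n}}} λ as → P? (a ∷ as))
    }

infix 4 _≟₄_ _≟ᵛ_ _≟ᵛ₄_ _≟ᴹ_ _≟ᵐ_ _≟ᵗ_

_≟₄_ : DecidableEquality F4
_≟₄_ = Enumeration.decEq f4-enumeration

_≟ᵛ_ : DecidableEquality V2
_≟ᵛ_ = Vec.≡-dec _≟ᵇ_

_≟ᵛ₄_ : DecidableEquality V4
_≟ᵛ₄_ = Vec.≡-dec _≟₄_

_≟ᴹ_ : DecidableEquality Mat
_≟ᴹ_ = Vec.≡-dec _≟ᵛ_

_≟ᵐ_ : DecidableEquality (Maybe F2)
_≟ᵐ_ = Maybe.≡-dec _≟ᵇ_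

_≟ᵗ_ : DecidableEquality LineType
_≟ᵗ_ = Enumeration.decEq lineType-enumeration

_⇔?_ : {A B : Set} → Dec A → Dec B → Dec (A ⇔ B)
A? ⇔? B? = map′ (λ (f , g) → mk⇔ f g) (λ e → to e , from e) ((A? →-dec B?) ×-dec (B? →-dec A?))

∀-⇔? : {A : Set} {P Q : A → Set} → Dec (∀ a → P a → Q a) → Dec (∀ a → Q a → P a) → Dec (∀ a → P a ⇔ Q a)
∀-⇔? P⇒Q? Q⇒P? = map′ (λ (f , g) a → mk⇔ (f a) (g a)) (λ h → (λ a → to (h a)) , (λ a → from (h a)))
                       (P⇒Q? ×-dec Q⇒P?)

open CommutativeRing xor-∧-commutativeRing using (+-commutativeSemigroup)
open CommutativeSemigroupProperties +-commutativeSemigroup using (interchange)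

dot : ∀ {n} → Vec F2 n → Vec F2 n → F2
dot x c = sum₂ (zipWith _*₂_ x c)

column : Fin 4 → Mat → V2
column j g = map (λ row → lookup row j) g

dot-distribʳ-⊕ : ∀ {n} (x y c : Vec F2 n) → dot (zipWith _+₂_ x y) c ≡ dot x c +₂ dot y c
dot-distribʳ-⊕ [] [] [] = refl
dot-distribʳ-⊕ (x ∷ xs) (y ∷ ys) (c ∷ cs) = begin
  ((x +₂ y) *₂ c) +₂ dot (zipWith _+₂_ xs ys) cs  ≡⟨ cong₂ _+₂_ (∧-distribʳ-xor c x y) (dot-distribʳ-⊕ xs ys cs) ⟩
  (x *₂ c +₂ y *₂ c) +₂ (dot xs cs +₂ dot ys cs)  ≡⟨ interchange (x *₂ c) (y *₂ c) (dot xs cs) (dot ys cs) ⟩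
  (x *₂ c +₂ dot xs cs) +₂ (y *₂ c +₂ dot ys cs)  ∎
  where open ≡-Reasoning

·-distribʳ-⊕ : ∀ X Y g → (X ⊕ Y) · g ≡ (X · g) ⊕ (Y · g)
·-distribʳ-⊕ X Y g = Vec.tabulate-cong λ j → dot-distribʳ-⊕ X Y (column j g)

infixr 25 _∙_
_∙_ : F2 → V2 → V2
y ∙ v = map (y *₂_) v

∙-· : ∀ y v g → (y ∙ v) · g ≡ y ∙ (v · g)
∙-· true  (a ∷ b ∷ c ∷ d ∷ []) g = refl
∙-· false (a ∷ b ∷ c ∷ d ∷ []) (r₀ ∷ r₁ ∷ r₂ ∷ r₃ ∷ []) = refl

0v-· : ∀ g → 0v₂ · g ≡ 0v₂
0v-· (r₀ ∷ r₁ ∷ r₂ ∷ r₃ ∷ []) = refl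

combination : ∀ {n} → Vec F2 n → Vec V2 n → V2
combination [] [] = 0v₂
combination (y ∷ ys) (r ∷ rs) = y ∙ r ⊕ combination ys rs

combination-· : ∀ {n} (ys : Vec F2 n) rs g → combination ys rs · g ≡ combination ys (map (_· g) rs)
combination-· [] [] g = 0v-· g
combination-· (y ∷ ys) (r ∷ rs) g = begin
  (y ∙ r ⊕ combination ys rs) · g              ≡⟨ ·-distribʳ-⊕ (y ∙ r) (combination ys rs) g ⟩
  ((y ∙ r) · g) ⊕ (combination ys rs · g)      ≡⟨ cong₂ _⊕_ (∙-· y r g) (combination-· ys rs g) ⟩
  y ∙ (r · g) ⊕ combination ys (map (_· g) rs) ∎
  where open ≡-Reasoning

·-as-combination : ∀ Y g → Y · g ≡ combination Y g
·-as-combination (y₀ ∷ y₁ ∷ y₂ ∷ y₃ ∷ [])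
  ((a₀ ∷ a₁ ∷ a₂ ∷ a₃ ∷ []) ∷ (b₀ ∷ b₁ ∷ b₂ ∷ b₃ ∷ []) ∷ (c₀ ∷ c₁ ∷ c₂ ∷ c₃ ∷ []) ∷ (d₀ ∷ d₁ ∷ d₂ ∷ d₃ ∷ []) ∷ []) = refl

·-assoc : ∀ Y g h → (Y · g) · h ≡ Y · (g ⊗ h)
·-assoc Y g h = begin
  (Y · g) · h            ≡⟨ cong (_· h) (·-as-combination Y g) ⟩
  combination Y g · h    ≡⟨ combination-· Y g h ⟩
  combination Y (g ⊗ h)  ≡⟨ sym (·-as-combination Y (g ⊗ h)) ⟩
  Y · (g ⊗ h)            ∎
  where open ≡-Reasoning

·-identityʳ : ∀ Y → Y · Id ≡ Y
·-identityʳ = from-yes (∀? λ Y → Y · Id ≟ᵛ Y)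

⊗-assoc : ∀ f g h → (f ⊗ g) ⊗ h ≡ f ⊗ (g ⊗ h)
⊗-assoc f g h = trans (sym (Vec.map-∘ (_· h) (_· g) f)) (Vec.map-cong (λ Y → ·-assoc Y g h) f)

⊗-identityʳ : ∀ g → g ⊗ Id ≡ g
⊗-identityʳ g = trans (Vec.map-cong ·-identityʳ g) (Vec.map-id g)

inverse-of-product : ∀ {f f′ g g′} → f ⊗ f′ ≡ Id → g ⊗ g′ ≡ Id → (f ⊗ g) ⊗ (g′ ⊗ f′) ≡ Id
inverse-of-product {f} {f′} {g} {g′} f⊗f′≡Id g⊗g′≡Id = begin
  (f ⊗ g) ⊗ (g′ ⊗ f′)  ≡⟨ sym (⊗-assoc (f ⊗ g) g′ f′) ⟩
  ((f ⊗ g) ⊗ g′) ⊗ f′  ≡⟨ cong (_⊗ f′) (⊗-assoc f g g′) ⟩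
  (f ⊗ (g ⊗ g′)) ⊗ f′  ≡⟨ cong (λ m → (f ⊗ m) ⊗ f′) g⊗g′≡Id ⟩
  (f ⊗ Id) ⊗ f′        ≡⟨ cong (_⊗ f′) (⊗-identityʳ f) ⟩
  f ⊗ f′               ≡⟨ f⊗f′≡Id ⟩
  Id                   ∎
  where open ≡-Reasoning

invertible-⊗ : ∀ {f g} → Invertible f → Invertible g → Invertible (f ⊗ g)
invertible-⊗ (f′ , ff′ , f′f) (g′ , gg′ , g′g) = g′ ⊗ f′ , inverse-of-product ff′ gg′ , inverse-of-product g′g f′f

invertible-cancel : ∀ {g} → (inv : Invertible g) → ∀ Y → (Y · g) · proj₁ inv ≡ Y
invertible-cancel {g} (h , g⊗h≡Id , _) Y = trans (·-assoc Y g h) (trans (cong (Y ·_) g⊗h≡Id) (·-identityʳ Y))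

invertible-injective : ∀ {g} → Invertible g → ∀ {X Y} → X · g ≡ Y · g → X ≡ Y
invertible-injective inv {X} {Y} Xg≡Yg =
  trans (sym (invertible-cancel inv X)) (trans (cong (_· proj₁ inv) Xg≡Yg) (invertible-cancel inv Y))

record Image (g : Mat) (L L′ : Line) : Set where
  constructor image
  field points : ∀ X → OnLine L′ X ⇔ (∃ λ Y → OnLine L Y × X ≡ Y · g)
open Image

image-⊗ : ∀ {g h A B C} → Image g A B → Image h B C → Image (g ⊗ h) A C
image-⊗ {g} {h} {A} {B} {C} (image A↦B) (image B↦C) = image λ X → mk⇔ (forth X) (back X)
  where
  forth : ∀ X → OnLine C X → ∃ λ Z → OnLine A Z × X ≡ Z · (g ⊗ h)
  forth X X∈C with to (B↦C X) X∈C
  ... | Y , Y∈B , refl with to (A↦B Y) Y∈B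
  ... | Z , Z∈A , refl = Z , Z∈A , ·-assoc Z g h
  back : ∀ X → (∃ λ Z → OnLine A Z × X ≡ Z · (g ⊗ h)) → OnLine C X
  back _ (Z , Z∈A , refl) =
    from (B↦C _) (Z · g , from (A↦B (Z · g)) (Z , Z∈A , refl) , sym (·-assoc Z g h))

image-inverse : ∀ {g h A B} → (∀ Y → (Y · g) · h ≡ Y) → Image g A B → Image h B A
image-inverse {g} {h} {A} {B} cancel (image A↦B) = image λ X → mk⇔ (forth X) (back X)
  where
  forth : ∀ X → OnLine A X → ∃ λ Y → OnLine B Y × X ≡ Y · h
  forth X X∈A = X · g , from (A↦B (X · g)) (X , X∈A , refl) , sym (cancel X)
  back : ∀ X → (∃ λ Y → OnLine B Y × X ≡ Y · h) → OnLine A X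
  back _ (Y , Y∈B , refl) with to (A↦B Y) Y∈B
  ... | Z , Z∈A , refl = subst (OnLine A) (sym (cancel Z)) Z∈A

image-frame : ∀ {g L L′} → Invertible g → Image g L L′ →
  OnLine L′ (p L · g) × OnLine L′ (q L · g) × p L · g ≢ q L · g
image-frame {g} {L} inv (image L↦L′) =
  from (L↦L′ (p L · g)) (p L , inj₁ refl , refl) ,
  from (L↦L′ (q L · g)) (q L , inj₂ (inj₁ refl) , refl) ,
  λ e → p≢q L (invertible-injective inv e)

record ProjectivityGroup (G : Mat → Set) : Set where
  field
    ⊗-closed : ∀ {g h} → G g → G h → G (g ⊗ h)
    inverse  : ∀ {g} → G g → ∃ λ h → G h × (∀ Y → (Y · g) · h ≡ Y)

module _ {G : Mat → Set} (group : ProjectivityGroup G) {I : Set} {S : I → Line → Set}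
         (κ : Line → I) (κ-spec : ∀ i L → S i L ⇔ κ L ≡ i)
         (rep : I → Line) (κ-rep : ∀ i → κ (rep i) ≡ i)
         (κ-invariant : ∀ {g L L′} → G g → Image g L L′ → κ L′ ≡ κ L)
         (transitive : ∀ L → ∃ λ g → G g × Image g (rep (κ L)) L)
         where
  open ProjectivityGroup group

  sameOrbit : ∀ {L L′} → κ L ≡ κ L′ → SameOrbit G L L′
  sameOrbit {L} {L′} κL≡κL′ with transitive L | transitive L′
  ... | g , Gg , r↦L | g′ , Gg′ , r↦L′ with inverse Gg
  ... | h , Gh , cancel =
    h ⊗ g′ , ⊗-closed Gh Gg′ ,
    points (image-⊗ (image-inverse cancel r↦L) (subst (λ i → Image g′ (rep i) L′) (sym κL≡κL′) r↦L′))

  orbitPartition : OrbitPartition G I S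
  orbitPartition = nonempty , covering , disjoint , orbits
    where
    nonempty : ∀ i → ∃ λ L → S i L
    nonempty i = rep i , from (κ-spec i (rep i)) (κ-rep i)
    covering : ∀ L → ∃ λ i → S i L
    covering L = κ L , from (κ-spec (κ L) L) refl
    disjoint : ∀ i j L → S i L → S j L → i ≡ j
    disjoint i j L Si Sj = trans (sym (to (κ-spec i L) Si)) (to (κ-spec j L) Sj)
    orbits : ∀ i L L′ → S i L → (S i L′ ⇔ SameOrbit G L L′)
    orbits i L L′ SiL = mk⇔
      (λ SiL′ → sameOrbit (trans (to (κ-spec i L) SiL) (sym (to (κ-spec i L′) SiL′))))
      (λ (g , Gg , L↦L′) → from (κ-spec i L′) (trans (κ-invariant Gg (image L↦L′)) (to (κ-spec i L) SiL)))

OnSpan? : ∀ A B → Decidable (OnSpan A B)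
OnSpan? A B X = (X ≟ᵛ A) ⊎-dec (X ≟ᵛ B) ⊎-dec (X ≟ᵛ A ⊕ B)

OnLine? : ∀ L → Decidable (OnLine L)
OnLine? L = OnSpan? (p L) (q L)

∀-onSpan? : ∀ A B {S : V2 → Set} → Decidable S → Dec (∀ X → OnSpan A B X → S X)
∀-onSpan? A B {S} S? = map′ forth back (S? A ×-dec S? B ×-dec S? (A ⊕ B))
  where
  forth : S A × S B × S (A ⊕ B) → ∀ X → OnSpan A B X → S X
  forth (SA , SB , SAB) _ (inj₁ refl) = SA
  forth (SA , SB , SAB) _ (inj₂ (inj₁ refl)) = SB
  forth (SA , SB , SAB) _ (inj₂ (inj₂ refl)) = SAB
  back : (∀ X → OnSpan A B X → S X) → S A × S B × S (A ⊕ B)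
  back h = h A (inj₁ refl) , h B (inj₂ (inj₁ refl)) , h (A ⊕ B) (inj₂ (inj₂ refl))

∃-onSpan? : ∀ A B {S : V2 → Set} → Decidable S → Dec (∃ λ X → OnSpan A B X × S X)
∃-onSpan? A B {S} S? = map′ forth back (S? A ⊎-dec S? B ⊎-dec S? (A ⊕ B))
  where
  forth : S A ⊎ S B ⊎ S (A ⊕ B) → ∃ λ X → OnSpan A B X × S X
  forth (inj₁ SA) = A , inj₁ refl , SA
  forth (inj₂ (inj₁ SB)) = B , inj₂ (inj₁ refl) , SB
  forth (inj₂ (inj₂ SAB)) = A ⊕ B , inj₂ (inj₂ refl) , SAB
  back : (∃ λ X → OnSpan A B X × S X) → S A ⊎ S B ⊎ S (A ⊕ B)
  back (_ , inj₁ refl , SA) = inj₁ SA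
  back (_ , inj₂ (inj₁ refl) , SB) = inj₂ (inj₁ SB)
  back (_ , inj₂ (inj₂ refl) , SAB) = inj₂ (inj₂ SAB)

∀-onC? : {S : V2 → Set} → Decidable S → Dec (∀ X → InC X → S X)
∀-onC? S? = map′ (λ { h _ (t , refl) → h t }) (λ h t → h (P2 t) (t , refl)) (∀? λ t → S? (P2 t))

∃-onC? : {S : V2 → Set} → Decidable S → Dec (∃ λ X → InC X × S X)
∃-onC? S? = map′ (λ (t , h) → P2 t , (t , refl) , h) (λ { (_ , (t , refl) , h) → t , h }) (∃? λ t → S? (P2 t))

InC? : Decidable InC
InC? X = ∃? λ t → X ≟ᵛ P2 t

InΓPlane? : ∀ t → Decidable (InΓPlane t)
InΓPlane? (just t) X = osc4 (ι t) (ιv X) ≟₄ 𝟎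
InΓPlane? nothing (x₀ ∷ x₁ ∷ x₂ ∷ x₃ ∷ []) = x₃ ≟ᵇ 0₂

InPlaneX1=X2? : Decidable InPlaneX1=X2
InPlaneX1=X2? (x₀ ∷ x₁ ∷ x₂ ∷ x₃ ∷ []) = x₁ ≟ᵇ x₂

ContainedIn? : ∀ L {S : V2 → Set} → Decidable S → Dec (ContainedIn L S)
ContainedIn? L = ∀-onSpan? (p L) (q L)

InSomeΓPlane? : Decidable InSomeΓPlane
InSomeΓPlane? L = ∃? λ t → ContainedIn? L (InΓPlane? t)

IsLineThrough? : ∀ L A B → Dec (IsLineThrough L A B)
IsLineThrough? L A B = ∀-⇔? (ContainedIn? L (OnSpan? A B)) (∀? λ X → OnSpan? A B X →-dec OnLine? L X)

extensionPoint : Line → F4 → F4 → V4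
extensionPoint L l m = zipWith _+₄_ (map (l *₄_) (ιv (p L))) (map (m *₄_) (ιv (q L)))

OnExt? : ∀ L → Decidable (OnExt L)
OnExt? L Y = ¬? (Y ≟ᵛ₄ 0v₄) ×-dec (∃? λ l → ∃? λ m → Y ≟ᵛ₄ extensionPoint L l m)

∀-onExt? : ∀ L {R : V4 → Set} → Decidable R → Dec (∀ Y → OnExt L Y → R Y)
∀-onExt? L R? = map′ (λ { h _ (Y≢0 , l , m , refl) → h l m Y≢0 }) (λ h l m Y≢0 → h _ (Y≢0 , l , m , refl))
  (∀? λ l → ∀? λ m → ¬? (extensionPoint L l m ≟ᵛ₄ 0v₄) →-dec R? (extensionPoint L l m))

NotInF2? : Decidable NotInF2
NotInF2? t = ¬? (t ≟₄ 𝟎) ×-dec ¬? (t ≟₄ 𝟏)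

RC? : Decidable RC
RC? L = map′ (λ (P , CP , Q , CQ , rest) → P , Q , CP , CQ , rest) (λ (P , Q , CP , CQ , rest) → P , CP , Q , CQ , rest)
  (∃-onC? λ P → ∃-onC? λ Q → ¬? (P ≟ᵛ Q) ×-dec OnLine? L P ×-dec OnLine? L Q)

RA? : Decidable RA
RA? L = ∃? λ s → ∃? λ t → ¬? (s ≟ᵐ t) ×-dec ∀-⇔? (ContainedIn? L (inBoth? s t)) (∀? λ X → inBoth? s t X →-dec OnLine? L X)
  where
  inBoth? : ∀ s t X → Dec ((X ≢ 0v₂) × InΓPlane s X × InΓPlane t X)
  inBoth? s t X = ¬? (X ≟ᵛ 0v₂) ×-dec InΓPlane? s X ×-dec InΓPlane? t X

IsTangent? : Decidable IsTangent
IsTangent? L = ∃? λ t → IsLineThrough? L (P2 t) (tangentDir t)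

IC? : Decidable IC
IC? L = ∃? λ t → NotInF2? t ×-dec OnExt? L (P4 t) ×-dec OnExt? L (P4 (t *₄ t))

IA? : Decidable IA
IA? L = ∃? λ t → NotInF2? t ×-dec ∀-⇔? (∀-onExt? L (onBoth? t)) (∀? λ Y → onBoth? t Y →-dec OnExt? L Y)
  where
  onBoth? : ∀ t Y → Dec ((Y ≢ 0v₄) × osc4 t Y ≡ 𝟎 × osc4 (t *₄ t) Y ≡ 𝟎)
  onBoth? t Y = ¬? (Y ≟ᵛ₄ 0v₄) ×-dec (osc4 t Y ≟₄ 𝟎) ×-dec (osc4 (t *₄ t) Y ≟₄ 𝟎)

Unisecant? : Decidable Unisecant
Unisecant? L = ∃-onC? λ P → OnLine? L P ×-dec ∀-onC? λ Q → OnLine? L Q →-dec Q ≟ᵛ P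

External? : Decidable External
External? L = ∀-onC? λ P → ¬? (OnLine? L P)

UΓ? : Decidable UΓ
UΓ? L = Unisecant? L ×-dec InSomeΓPlane? L ×-dec ¬? (IsTangent? L)

HasType? : ∀ t → Decidable (HasType t)
HasType? rc      = RC?
HasType? ia      = IA?
HasType? uγ₂ L   = UΓ? L ×-dec ContainedIn? L InPlaneX1=X2?
HasType? ra      = RA?
HasType? ic      = IC?
HasType? tl      = IsTangent?
HasType? uγ₁ L   = UΓ? L ×-dec ¬? (ContainedIn? L InPlaneX1=X2?)
HasType? unγ L   = Unisecant? L ×-dec ¬? (InSomeΓPlane? L)
HasType? eγ  L   = External? L ×-dec InSomeΓPlane? L ×-dec ¬? (RA? L)
HasType? enγ L   = External? L ×-dec ¬? (InSomeΓPlane? L) ×-dec ¬? (IC? L) ×-dec ¬? (IA? L)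

-- The only IC-line of PG(3,2) joins P(ω) and P(ω²); the only IA-line is
-- {P + Z | P ∈ C}, Z the centre. Each is recognised by two of its F₂-points.
lineType : V2 → V2 → LineType
lineType x y
  with count InC? (x ∷ y ∷ x ⊕ y ∷ []) | joins iaPoint₁ iaPoint₂ | joins icPoint₁ icPoint₂
     | count (λ s → ∀-onSpan? x y (InΓPlane? s)) (nothing ∷ just false ∷ just true ∷ [])
     | does (∃? λ t → OnSpan? x y (P2 t) ×-dec OnSpan? x y (tangentDir t))
     | does (∀-onSpan? x y InPlaneX1=X2?)
  where
  joins : V2 → V2 → Bool
  joins A B = does (OnSpan? x y A) ∧ does (OnSpan? x y B)
  iaPoint₁ iaPoint₂ icPoint₁ icPoint₂ : V2
  iaPoint₁ = false ∷ true ∷ true ∷ true ∷ []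
  iaPoint₂ = true ∷ false ∷ false ∷ true ∷ []
  icPoint₁ = false ∷ true ∷ true ∷ false ∷ []
  icPoint₂ = true ∷ false ∷ true ∷ true ∷ []
... | ℕ.suc (ℕ.suc _) | _     | _     | _                 | _     | _     = rc
... | _               | true  | _     | _                 | _     | _     = ia
... | _               | false | true  | _                 | _     | _     = ic
... | _               | false | false | ℕ.suc (ℕ.suc _)   | _     | _     = ra
... | _               | false | false | _                 | true  | _     = tl
... | 1               | false | false | 1                 | false | true  = uγ₂
... | 1               | false | false | 1                 | false | false = uγ₁
... | 1               | false | false | 0                 | false | _     = unγ
... | 0               | false | false | 1                 | false | _     = eγ
... | 0               | false | false | 0                 | false | _     = enγ

typeOf : Line → LineType
typeOf L = lineType (p L) (q L)

-- A line carries non-degeneracy proofs that the predicates on lines never inspect, so a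
-- decidable predicate insensitive to them can be decided over all pairs of points.
∀-line? : {P : Line → Set} →
  (∀ {x y a b c a′ b′ c′} → P (mkLine x y a b c) → P (mkLine x y a′ b′ c′)) →
  (∀ L → Dec (P L)) → Dec (∀ L → P L)
∀-line? {P} irrelevant P? =
  map′ (λ h L → h (p L) (q L) (p≢0 L) (q≢0 L) (p≢q L)) (λ h x y a b c → h (mkLine x y a b c))
       (∀? λ x → ∀? λ y → through? x y)
  where
  through? : ∀ x y → Dec (∀ a b c → P (mkLine x y a b c))
  through? x y with x ≟ᵛ 0v₂ | y ≟ᵛ 0v₂ | x ≟ᵛ y
  ... | yes x≡0 | _       | _       = yes λ a _ _ → ⊥-elim (a x≡0)
  ... | no _    | yes y≡0 | _       = yes λ _ b _ → ⊥-elim (b y≡0)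
  ... | no _    | no _    | yes x≡y = yes λ _ _ c → ⊥-elim (c x≡y)
  ... | no a    | no b    | no c    = map′ (λ h _ _ _ → irrelevant h) (λ h → h a b c) (P? (mkLine x y a b c))

hasType-irrelevant : ∀ t {x y a b c a′ b′ c′} → HasType t (mkLine x y a b c) → HasType t (mkLine x y a′ b′ c′)
hasType-irrelevant rc  h = h
hasType-irrelevant ia  h = h
hasType-irrelevant uγ₂ h = h
hasType-irrelevant ra  h = h
hasType-irrelevant ic  h = h
hasType-irrelevant tl  h = h
hasType-irrelevant uγ₁ h = h
hasType-irrelevant unγ h = h
hasType-irrelevant eγ  h = h
hasType-irrelevant enγ h = h

TypeSpec : Line → Set
TypeSpec L = ∀ t → HasType t L ⇔ typeOf L ≡ t

typeSpec-irrelevant : ∀ {x y a b c a′ b′ c′} → TypeSpec (mkLine x y a b c) → TypeSpec (mkLine x y a′ b′ c′)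
typeSpec-irrelevant spec t =
  mk⇔ (λ h → to (spec t) (hasType-irrelevant t h)) (λ e → hasType-irrelevant t (from (spec t) e))

Image? : ∀ g R L → Dec (Image g R L)
Image? g R L = map′ image points $ ∀-⇔?
  (ContainedIn? L λ X → ∃-onSpan? (p R) (q R) λ Y → X ≟ᵛ Y · g)
  (map′ (λ { h _ (Y , Y∈R , refl) → h Y Y∈R }) (λ h Y Y∈R → h (Y · g) (Y , Y∈R , refl))
        (ContainedIn? R λ Y → OnLine? L (Y · g)))

representative : LineType → Line
representative rc  = mkLine (false ∷ true ∷ true ∷ true ∷ [])   (true ∷ false ∷ false ∷ false ∷ []) (λ ()) (λ ()) (λ ())
representative ia  = mkLine (false ∷ true ∷ true ∷ true ∷ [])   (true ∷ false ∷ false ∷ true ∷ [])  (λ ()) (λ ()) (λ ())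
representative uγ₂ = mkLine (false ∷ true ∷ true ∷ false ∷ [])  (true ∷ false ∷ false ∷ true ∷ [])  (λ ()) (λ ()) (λ ())
representative ra  = mkLine (false ∷ false ∷ true ∷ false ∷ []) (false ∷ true ∷ false ∷ false ∷ []) (λ ()) (λ ()) (λ ())
representative ic  = mkLine (false ∷ true ∷ true ∷ false ∷ [])  (true ∷ false ∷ true ∷ true ∷ [])   (λ ()) (λ ()) (λ ())
representative tl  = mkLine (false ∷ true ∷ false ∷ false ∷ []) (true ∷ false ∷ false ∷ false ∷ []) (λ ()) (λ ()) (λ ())
representative uγ₁ = mkLine (false ∷ false ∷ true ∷ true ∷ [])  (true ∷ true ∷ false ∷ false ∷ [])  (λ ()) (λ ()) (λ ())
representative unγ = mkLine (false ∷ true ∷ false ∷ true ∷ [])  (true ∷ false ∷ false ∷ false ∷ []) (λ ()) (λ ()) (λ ())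
representative eγ  = mkLine (false ∷ false ∷ true ∷ false ∷ []) (true ∷ true ∷ false ∷ false ∷ [])  (λ ()) (λ ()) (λ ())
representative enγ = mkLine (false ∷ true ∷ false ∷ false ∷ []) (true ∷ false ∷ false ∷ true ∷ [])  (λ ()) (λ ()) (λ ())

abstract
  hasType⇔typeOf : ∀ L t → HasType t L ⇔ typeOf L ≡ t
  hasType⇔typeOf = from-yes (∀-line? typeSpec-irrelevant λ L → ∀? λ t → HasType? t L ⇔? (typeOf L ≟ᵗ t))

  lineType-of-points : ∀ L X → OnLine L X → ∀ Y → OnLine L Y → X ≢ Y → lineType X Y ≡ typeOf L
  lineType-of-points = from-yes (∀-line? (λ h → h) λ L →
    ContainedIn? L λ X → ∀? λ Y → OnLine? L Y →-dec (¬? (X ≟ᵛ Y) →-dec (lineType X Y ≟ᵗ typeOf L)))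

  typeOf-representative : ∀ t → typeOf (representative t) ≡ t
  typeOf-representative = from-yes (∀? λ t → typeOf (representative t) ≟ᵗ t)

det : F2 → F2 → F2 → F2 → F2
det a b c d = (a *₂ d) -₂ (b *₂ c)

det-transpose : ∀ a b c d → det d b c a ≡ det a b c d
det-transpose a b c d = cong (_-₂ (b *₂ c)) (∧-comm d a)

*₂-nonzero : ∀ {x y} → x ≢ 0₂ → y ≢ 0₂ → x *₂ y ≢ 0₂
*₂-nonzero {true}  {true}  _   _   ()
*₂-nonzero {false} {_}     x≢0 _   = λ _ → x≢0 refl
*₂-nonzero {true}  {false} _   y≢0 = λ _ → y≢0 refl

MapsCInto : Mat → Set
MapsCInto g = ∀ t → ∃ λ s → P2 t · g ≡ P2 s

MapsCOnto : Mat → Set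
MapsCOnto g = ∀ s → ∃ λ t → P2 t · g ≡ P2 s

abstract
  -- M(a,b,c,d) is the action on cubics of the matrix (a c ; b d) of GL(2,2), so M is multiplicative.
  M-⊗ : ∀ a b c d a′ b′ c′ d′ → M a b c d ⊗ M a′ b′ c′ d′ ≡
    M (a *₂ a′ +₂ c *₂ b′) (b *₂ a′ +₂ d *₂ b′) (a *₂ c′ +₂ c *₂ d′) (b *₂ c′ +₂ d *₂ d′)
  M-⊗ = from-yes (∀? λ a → ∀? λ b → ∀? λ c → ∀? λ d → ∀? λ a′ → ∀? λ b′ → ∀? λ c′ → ∀? λ d′ →
    M a b c d ⊗ M a′ b′ c′ d′ ≟ᴹ
    M (a *₂ a′ +₂ c *₂ b′) (b *₂ a′ +₂ d *₂ b′) (a *₂ c′ +₂ c *₂ d′) (b *₂ c′ +₂ d *₂ d′))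

  det-⊗ : ∀ a b c d a′ b′ c′ d′ →
    det (a *₂ a′ +₂ c *₂ b′) (b *₂ a′ +₂ d *₂ b′) (a *₂ c′ +₂ c *₂ d′) (b *₂ c′ +₂ d *₂ d′) ≡
    det a b c d *₂ det a′ b′ c′ d′
  det-⊗ = from-yes (∀? λ a → ∀? λ b → ∀? λ c → ∀? λ d → ∀? λ a′ → ∀? λ b′ → ∀? λ c′ → ∀? λ d′ →
    det (a *₂ a′ +₂ c *₂ b′) (b *₂ a′ +₂ d *₂ b′) (a *₂ c′ +₂ c *₂ d′) (b *₂ c′ +₂ d *₂ d′) ≟ᵇ
    det a b c d *₂ det a′ b′ c′ d′)

  M-inverse : ∀ a b c d → det a b c d ≢ 0₂ → M a b c d ⊗ M d b c a ≡ Id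
  M-inverse = from-yes (∀? λ a → ∀? λ b → ∀? λ c → ∀? λ d →
    ¬? (det a b c d ≟ᵇ 0₂) →-dec (M a b c d ⊗ M d b c a ≟ᴹ Id))

  M-maps-C : ∀ a b c d → det a b c d ≢ 0₂ → MapsCInto (M a b c d) × MapsCOnto (M a b c d)
  M-maps-C = from-yes (∀? λ a → ∀? λ b → ∀? λ c → ∀? λ d → ¬? (det a b c d ≟ᵇ 0₂) →-dec
    ((∀? λ t → ∃? λ s → P2 t · M a b c d ≟ᵛ P2 s) ×-dec (∀? λ s → ∃? λ t → P2 t · M a b c d ≟ᵛ P2 s)))

  lineType-M-invariant : ∀ a b c d → det a b c d ≢ 0₂ → ∀ L →
    lineType (p L · M a b c d) (q L · M a b c d) ≡ typeOf L
  lineType-M-invariant = from-yes (∀? λ a → ∀? λ b → ∀? λ c → ∀? λ d → ¬? (det a b c d ≟ᵇ 0₂) →-dec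
    ∀-line? (λ h → h) λ L → lineType (p L · M a b c d) (q L · M a b c d) ≟ᵗ typeOf L)

  M-transitive : ∀ L → ∃ λ a → ∃ λ b → ∃ λ c → ∃ λ d →
    det a b c d ≢ 0₂ × Image (M a b c d) (representative (typeOf L)) L
  M-transitive = from-yes (∀-line? (λ (a , b , c , d , Δ≢0 , img) → a , b , c , d , Δ≢0 , image (points img)) λ L →
    ∃? λ a → ∃? λ b → ∃? λ c → ∃? λ d → ¬? (det a b c d ≟ᵇ 0₂) ×-dec Image? (M a b c d) (representative (typeOf L)) L)

G2*-group : ProjectivityGroup G2*
G2*-group = record { ⊗-closed = closed ; inverse = inverse }
  where
  closed : ∀ {g h} → G2* g → G2* h → G2* (g ⊗ h)
  closed (a , b , c , d , Δ≢0 , refl) (a′ , b′ , c′ , d′ , Δ′≢0 , refl) =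
    a *₂ a′ +₂ c *₂ b′ , b *₂ a′ +₂ d *₂ b′ , a *₂ c′ +₂ c *₂ d′ , b *₂ c′ +₂ d *₂ d′ ,
    subst (_≢ 0₂) (sym (det-⊗ a b c d a′ b′ c′ d′)) (*₂-nonzero Δ≢0 Δ′≢0) , M-⊗ a b c d a′ b′ c′ d′
  inverse : ∀ {g} → G2* g → ∃ λ h → G2* h × (∀ Y → (Y · g) · h ≡ Y)
  inverse (a , b , c , d , Δ≢0 , refl) =
    M d b c a , (d , b , c , a , subst (_≢ 0₂) (sym (det-transpose a b c d)) Δ≢0 , refl) ,
    λ Y → trans (·-assoc Y (M a b c d) (M d b c a)) (trans (cong (Y ·_) (M-inverse a b c d Δ≢0)) (·-identityʳ Y))

G2*⊆G2 : ∀ {g} → G2* g → G2 g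
G2*⊆G2 (a , b , c , d , Δ≢0 , refl) =
  (M d b c a , M-inverse a b c d Δ≢0 , M-inverse d b c a (subst (_≢ 0₂) (sym (det-transpose a b c d)) Δ≢0)) ,
  M-maps-C a b c d Δ≢0

typeOf-G2*-invariant : ∀ {g L L′} → G2* g → Image g L L′ → typeOf L′ ≡ typeOf L
typeOf-G2*-invariant {L = L} {L′} G@(a , b , c , d , Δ≢0 , refl) L↦L′
  with image-frame (proj₁ (G2*⊆G2 G)) L↦L′
... | X∈L′ , Y∈L′ , X≢Y =
  trans (sym (lineType-of-points L′ (p L · M a b c d) X∈L′ (q L · M a b c d) Y∈L′ X≢Y))
        (lineType-M-invariant a b c d Δ≢0 L)

G2*-transitive : ∀ L → ∃ λ g → G2* g × Image g (representative (typeOf L)) L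
G2*-transitive L with M-transitive L
... | a , b , c , d , Δ≢0 , r↦L = M a b c d , (a , b , c , d , Δ≢0 , refl) , r↦L

G2-group : ProjectivityGroup G2
G2-group = record { ⊗-closed = closed ; inverse = inverse }
  where
  closed : ∀ {f g} → G2 f → G2 g → G2 (f ⊗ g)
  closed {f} {g} (f-inv , f-into , f-onto) (g-inv , g-into , g-onto) = invertible-⊗ f-inv g-inv , into , onto
    where
    into : MapsCInto (f ⊗ g)
    into t with f-into t
    ... | s , e with g-into s
    ... | s′ , e′ = s′ , trans (sym (·-assoc (P2 t) f g)) (trans (cong (_· g) e) e′)
    onto : MapsCOnto (f ⊗ g)
    onto s with g-onto s
    ... | t′ , e′ with f-onto t′
    ... | t , e = t , trans (sym (·-assoc (P2 t) f g)) (trans (cong (_· g) e) e′)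
  inverse : ∀ {g} → G2 g → ∃ λ h → G2 h × (∀ Y → (Y · g) · h ≡ Y)
  inverse {g} (inv@(h , g⊗h≡Id , h⊗g≡Id) , into , onto) =
    h , ((g , h⊗g≡Id , g⊗h≡Id) , h-into , h-onto) , invertible-cancel inv
    where
    h-into : MapsCInto h
    h-into t with onto t
    ... | t′ , e = t′ , trans (cong (_· h) (sym e)) (invertible-cancel inv (P2 t′))
    h-onto : MapsCOnto h
    h-onto s with into s
    ... | s′ , e = s′ , trans (cong (_· h) (sym e)) (invertible-cancel inv (P2 s))

involution-G2 : ∀ {g} → g ⊗ g ≡ Id → MapsCInto g → G2 g
involution-G2 {g} g⊗g≡Id into = inv , into , onto
  where
  inv : Invertible g
  inv = g , g⊗g≡Id , g⊗g≡Id
  onto : MapsCOnto g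
  onto s with into s
  ... | t , e = t , trans (cong (_· g) (sym e)) (invertible-cancel inv (P2 s))

inC-invariant : ∀ {g} → G2 g → ∀ X → InC (X · g) ⇔ InC X
inC-invariant {g} (inv , into , onto) X = mk⇔ forth back
  where
  forth : InC (X · g) → InC X
  forth (s , e) with onto s
  ... | t , e′ = t , invertible-injective inv (trans e (sym e′))
  back : InC X → InC (X · g)
  back (t , refl) = into t

centre : V2
centre = (P2 nothing ⊕ P2 (just false)) ⊕ P2 (just true)

abstract
  sum-of-distinct-points : ∀ s t u → s ≢ t → s ≢ u → t ≢ u → (P2 s ⊕ P2 t) ⊕ P2 u ≡ centre
  sum-of-distinct-points = from-yes (∀? λ s → ∀? λ t → ∀? λ u →
    ¬? (s ≟ᵐ t) →-dec ¬? (s ≟ᵐ u) →-dec ¬? (t ≟ᵐ u) →-dec ((P2 s ⊕ P2 t) ⊕ P2 u ≟ᵛ centre))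

G2-fixes-centre : ∀ {g} → G2 g → centre · g ≡ centre
G2-fixes-centre {g} (inv , into , _) with into nothing | into (just false) | into (just true)
... | s , e∞ | t , e₀ | u , e₁ = begin
  centre · g                        ≡⟨ ·-distribʳ-⊕ (P∞ ⊕ P₀) P₁ g ⟩
  ((P∞ ⊕ P₀) · g) ⊕ (P₁ · g)        ≡⟨ cong (_⊕ (P₁ · g)) (·-distribʳ-⊕ P∞ P₀ g) ⟩
  ((P∞ · g) ⊕ (P₀ · g)) ⊕ (P₁ · g)  ≡⟨ cong₂ _⊕_ (cong₂ _⊕_ e∞ e₀) e₁ ⟩
  (P2 s ⊕ P2 t) ⊕ P2 u              ≡⟨ sum-of-distinct-points s t u
                                         (distinct P∞ P₀ e∞ e₀ λ ()) (distinct P∞ P₁ e∞ e₁ λ ()) (distinct P₀ P₁ e₀ e₁ λ ()) ⟩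
  centre                            ∎
  where
  open ≡-Reasoning
  P∞ P₀ P₁ : V2
  P∞ = P2 nothing
  P₀ = P2 (just false)
  P₁ = P2 (just true)
  distinct : ∀ {s t} X Y → X · g ≡ P2 s → Y · g ≡ P2 t → X ≢ Y → s ≢ t
  distinct X Y eX eY X≢Y refl = X≢Y (invertible-injective inv (trans eX (sym eY)))

centre-invariant : ∀ {g} → G2 g → ∀ X → X · g ≡ centre ⇔ X ≡ centre
centre-invariant G X =
  mk⇔ (λ e → invertible-injective (proj₁ G) (trans e (sym (G2-fixes-centre G)))) (λ { refl → G2-fixes-centre G })

chord-invariant : ∀ {g} → G2 g → ∀ X → InC ((X · g) ⊕ centre) ⇔ InC (X ⊕ centre)
chord-invariant {g} G X = subst (λ Y → InC Y ⇔ InC (X ⊕ centre))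
  (trans (·-distribʳ-⊕ X centre g) (cong ((X · g) ⊕_) (G2-fixes-centre G))) (inC-invariant G (X ⊕ centre))

data PointKind : Set where
  onCubic atCentre onChord offPlane : PointKind

pointKind : Bool → Bool → Bool → PointKind
pointKind true  _     _     = onCubic
pointKind false true  _     = atCentre
pointKind false false true  = onChord
pointKind false false false = offPlane

kind : V2 → PointKind
kind X = pointKind (does (InC? X)) (does (X ≟ᵛ centre)) (does (InC? (X ⊕ centre)))

kind-invariant : ∀ {g} → G2 g → ∀ X → kind (X · g) ≡ kind X
kind-invariant {g} G X
  rewrite does-⇔ (inC-invariant G X) (InC? (X · g)) (InC? X)
        | does-⇔ (centre-invariant G X) (X · g ≟ᵛ centre) (X ≟ᵛ centre)
        | does-⇔ (chord-invariant G X) (InC? ((X · g) ⊕ centre)) (InC? (X ⊕ centre))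
        = refl

PointKinds : Set
PointKinds = PointKind × PointKind × PointKind

kindsOf : V2 → V2 → PointKinds
kindsOf X Y = kind X , kind Y , kind (X ⊕ Y)

kindsOf-invariant : ∀ {g} → G2 g → ∀ X Y → kindsOf (X · g) (Y · g) ≡ kindsOf X Y
kindsOf-invariant {g} G X Y =
  cong₂ _,_ (kind-invariant G X) (cong₂ _,_ (kind-invariant G Y)
    (trans (cong kind (sym (·-distribʳ-⊕ X Y g))) (kind-invariant G (X ⊕ Y))))

cubic : PointKind → ℕ
cubic onCubic = 1
cubic _       = 0

inPlane : PointKind → Bool
inPlane offPlane = false
inPlane _        = true

isCentre : PointKind → Bool
isCentre atCentre = true
isCentre _        = false

classOfKinds : PointKinds → Fin 6
classOfKinds (k₁ , k₂ , k₃)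
  with cubic k₁ + cubic k₂ + cubic k₃ | inPlane k₁ ∧ inPlane k₂ ∧ inPlane k₃ | isCentre k₁ ∨ isCentre k₂ ∨ isCentre k₃
... | 0 | true  | _     = # 1
... | 0 | false | true  = # 3
... | 0 | false | false = # 5
... | 1 | true  | _     = # 2
... | 1 | false | _     = # 4
... | _ | _     | _     = # 0

orbitClass : LineType → Fin 6
orbitClass rc  = # 0
orbitClass ia  = # 1
orbitClass uγ₂ = # 2
orbitClass ra  = # 3
orbitClass ic  = # 3
orbitClass tl  = # 4
orbitClass uγ₁ = # 4
orbitClass unγ = # 4
orbitClass eγ  = # 5
orbitClass enγ = # 5

leader : Fin 6 → LineType
leader = lookup (rc ∷ ia ∷ uγ₂ ∷ ra ∷ tl ∷ eγ ∷ [])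

-- Involutions of G₂, found by search, carrying the representative of the leader of each
-- G₂-class to those of the other types in it.
merger : LineType → Mat
merger ic  = (true ∷ false ∷ false ∷ false ∷ []) ∷ (true ∷ false ∷ true ∷ true ∷ []) ∷
             (true ∷ true ∷ false ∷ true ∷ []) ∷ (false ∷ false ∷ false ∷ true ∷ []) ∷ []
merger uγ₁ = (true ∷ true ∷ true ∷ true ∷ []) ∷ (false ∷ false ∷ true ∷ true ∷ []) ∷
             (false ∷ true ∷ false ∷ true ∷ []) ∷ (false ∷ false ∷ false ∷ true ∷ []) ∷ []
merger unγ = (true ∷ false ∷ false ∷ false ∷ []) ∷ (false ∷ true ∷ false ∷ true ∷ []) ∷
             (false ∷ false ∷ true ∷ true ∷ []) ∷ (false ∷ false ∷ false ∷ true ∷ []) ∷ []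
merger enγ = (true ∷ true ∷ true ∷ true ∷ []) ∷ (false ∷ false ∷ true ∷ false ∷ []) ∷
             (false ∷ true ∷ false ∷ false ∷ []) ∷ (false ∷ false ∷ false ∷ true ∷ []) ∷ []
merger _   = Id

abstract
  orbitClass-by-kinds : ∀ L X → OnLine L X → ∀ Y → OnLine L Y → X ≢ Y →
    orbitClass (typeOf L) ≡ classOfKinds (kindsOf X Y)
  orbitClass-by-kinds = from-yes (∀-line? (λ h → h) λ L → ContainedIn? L λ X → ∀? λ Y →
    OnLine? L Y →-dec (¬? (X ≟ᵛ Y) →-dec (orbitClass (typeOf L) ≟ᶠ classOfKinds (kindsOf X Y))))

  orbitClass-leader : ∀ i → orbitClass (leader i) ≡ i
  orbitClass-leader = from-yes (∀? λ i → orbitClass (leader i) ≟ᶠ i)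

  merger-involution : ∀ t → merger t ⊗ merger t ≡ Id
  merger-involution = from-yes (∀? λ t → merger t ⊗ merger t ≟ᴹ Id)

  merger-maps-C : ∀ t → MapsCInto (merger t)
  merger-maps-C = from-yes (∀? λ t → ∀? λ u → ∃? λ s → P2 u · merger t ≟ᵛ P2 s)

  merger-image : ∀ t → Image (merger t) (representative (leader (orbitClass t))) (representative t)
  merger-image = from-yes (∀? λ t → Image? (merger t) (representative (leader (orbitClass t))) (representative t))

orbitClass-G2-invariant : ∀ {g L L′} → G2 g → Image g L L′ → orbitClass (typeOf L′) ≡ orbitClass (typeOf L)
orbitClass-G2-invariant {g} {L} {L′} G L↦L′ with image-frame (proj₁ G) L↦L′
... | X∈L′ , Y∈L′ , X≢Y = begin
  orbitClass (typeOf L′)                     ≡⟨ orbitClass-by-kinds L′ (p L · g) X∈L′ (q L · g) Y∈L′ X≢Y ⟩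
  classOfKinds (kindsOf (p L · g) (q L · g)) ≡⟨ cong classOfKinds (kindsOf-invariant G (p L) (q L)) ⟩
  classOfKinds (kindsOf (p L) (q L))         ≡⟨ sym (orbitClass-by-kinds L (p L) (inj₁ refl) (q L) (inj₂ (inj₁ refl)) (p≢q L)) ⟩
  orbitClass (typeOf L)                      ∎
  where open ≡-Reasoning

G2-transitive : ∀ L → ∃ λ g → G2 g × Image g (representative (leader (orbitClass (typeOf L)))) L
G2-transitive L with G2*-transitive L
... | g , G , r↦L =
  merger t ⊗ g ,
  ProjectivityGroup.⊗-closed G2-group (involution-G2 (merger-involution t) (merger-maps-C t)) (G2*⊆G2 G) ,
  image-⊗ (merger-image t) r↦L
  where t = typeOf L

orbitClass-representative : ∀ i → orbitClass (typeOf (representative (leader i))) ≡ i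
orbitClass-representative i = trans (cong orbitClass (typeOf-representative (leader i))) (orbitClass-leader i)

inClass-type : ∀ i {L} → InClass i L → ∃ λ t → orbitClass t ≡ i × HasType t L
inClass-type zero h = rc , refl , h
inClass-type (suc zero) h = ia , refl , h
inClass-type (suc (suc zero)) h = uγ₂ , refl , h
inClass-type (suc (suc (suc zero))) (inj₁ h) = ra , refl , h
inClass-type (suc (suc (suc zero))) (inj₂ h) = ic , refl , h
inClass-type (suc (suc (suc (suc zero)))) (inj₁ h) = tl , refl , h
inClass-type (suc (suc (suc (suc zero)))) (inj₂ (inj₁ h)) = uγ₁ , refl , h
inClass-type (suc (suc (suc (suc zero)))) (inj₂ (inj₂ h)) = unγ , refl , h
inClass-type (suc (suc (suc (suc (suc zero))))) (inj₁ h) = eγ , refl , h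
inClass-type (suc (suc (suc (suc (suc zero))))) (inj₂ h) = enγ , refl , h

type-inClass : ∀ t {L} → HasType t L → InClass (orbitClass t) L
type-inClass rc  h = h
type-inClass ia  h = h
type-inClass uγ₂ h = h
type-inClass ra  h = inj₁ h
type-inClass ic  h = inj₂ h
type-inClass tl  h = inj₁ h
type-inClass uγ₁ h = inj₂ (inj₁ h)
type-inClass unγ h = inj₂ (inj₂ h)
type-inClass eγ  h = inj₁ h
type-inClass enγ h = inj₂ h

inClass⇔orbitClass : ∀ i L → InClass i L ⇔ orbitClass (typeOf L) ≡ i
inClass⇔orbitClass i L = mk⇔ forth back
  where
  forth : InClass i L → orbitClass (typeOf L) ≡ i
  forth h with inClass-type i h
  ... | t , refl , H = cong orbitClass (to (hasType⇔typeOf L t) H)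
  back : orbitClass (typeOf L) ≡ i → InClass i L
  back refl = type-inClass (typeOf L) (from (hasType⇔typeOf L (typeOf L)) refl)

theorem4p4 : OrbitPartition G2 (Fin 6) InClass × OrbitPartition G2* LineType HasType
theorem4p4 =
  orbitPartition G2-group {S = InClass} (λ L → orbitClass (typeOf L)) inClass⇔orbitClass
    (λ i → representative (leader i)) orbitClass-representative orbitClass-G2-invariant G2-transitive ,
  orbitPartition G2*-group {S = HasType} typeOf (λ t L → hasType⇔typeOf L t)
    representative typeOf-representative typeOf-G2*-invariant G2*-transitive
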